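{- Let $g,h$ be distinct free generators of the free group $F(g,h)$, and for $n\ge1$ let $u_n=[g,h]_n$ be the freely reduced word defined by $[g,h]_1=gh^{ -1}g^{ -1}h$ and $[g,h]_n=[g,[g,h]_{n-1}]_1$, i.e. $g\,[g,h]_{n-1}^{ -1}\,g^{ -1}\,[g,h]_{n-1}$ after free reduction. Then for all $n\ge1$, no square word in $g$ and $h$ is a cyclic subword of $u_n$.
   Context: A cyclic permutation of a word $a_1\dots a_m$ is a word $a_k\dots a_m a_1\dots a_{k-1}$ for some $k\in\{1,\dots,m\}$. A word $v$ is a cyclic subword of $w$ if $v$ or $v^{ -1}$ is a (contiguous) subword of some cyclic permutation of $w$. The square words in $g$ and $h$ are the eight words obtained from $ghgh$ and $gh^{ -1}gh^{ -1}$ by cyclic permutations and inversions, namely $ghgh$, $hghg$, $h^{ -1}g^{ -1}h^{ -1}g^{ -1}$, $g^{ -1}h^{ -1}g^{ -1}h^{ -1}$, $gh^{ -1}gh^{ -1}$, $h^{ -1}gh^{ -1}g$, $hg^{ -1}hg^{ -1}$, $g^{ -1}hg^{ -1}h$. -}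

module Defs where

open import Data.Nat using (ℕ; zero; suc; _<_)
open import Data.List using (List; []; _∷_; _++_; foldr; reverse; map; take; drop; length)
open import Data.Product using (Σ; ∃; _×_; _,_)
open import Data.Sum using (_⊎_)
open import Relation.Binary.PropositionalEquality using (_≡_)

data Letter : Set where
  g g⁻ h h⁻ : Letter

Word : Set
Word = List Letter

invL : Letter → Letter
invL g = g⁻
invL g⁻ = g
invL h = h⁻
invL h⁻ = h

inv : Word → Word
inv w = reverse (map invL w)


push : Letter → Word → Word
push x [] = x ∷ []
push g (g⁻ ∷ ys) = ys
push g⁻ (g ∷ ys) = ys
push h (h⁻ ∷ ys) = ys
push h⁻ (h ∷ ys) = ys
push x (y ∷ ys) = x ∷ y ∷ ys

reduce : Word → Word
reduce = foldr push []

comm1 : Word → Word → Word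
comm1 x y = reduce (x ++ inv y ++ inv x ++ y)

-- u n = [g,h]_n for n ≥ 1 (u 0 is an unused dummy value)
u : ℕ → Word
u zero = []
u (suc zero) = comm1 (g ∷ []) (h ∷ [])
u (suc (suc n)) = comm1 (g ∷ []) (u (suc n))

-- cyclic permutation a_k … a_m a_1 … a_{k-1}, i.e. rotation by k-1 = i
rotate : ℕ → Word → Word
rotate i w = drop i w ++ take i w

Subword : Word → Word → Set
Subword v w = Σ Word λ xs → Σ Word λ ys → w ≡ xs ++ v ++ ys

CyclicSubword : Word → Word → Set
CyclicSubword v w =
  Σ ℕ λ i → (i < length w) × (Subword v (rotate i w) ⊎ Subword (inv v) (rotate i w))

squareWords : List Word
squareWords =
    (g ∷ h ∷ g ∷ h ∷ [])
  ∷ (h ∷ g ∷ h ∷ g ∷ [])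
  ∷ (h⁻ ∷ g⁻ ∷ h⁻ ∷ g⁻ ∷ [])
  ∷ (g⁻ ∷ h⁻ ∷ g⁻ ∷ h⁻ ∷ [])
  ∷ (g ∷ h⁻ ∷ g ∷ h⁻ ∷ [])
  ∷ (h⁻ ∷ g ∷ h⁻ ∷ g ∷ [])
  ∷ (h ∷ g⁻ ∷ h ∷ g⁻ ∷ [])
  ∷ (g⁻ ∷ h ∷ g⁻ ∷ h ∷ [])
  ∷ []

{-# OPTIONS --safe #-}
-- Writing u_n = g t_n, one has t_{n+1} = t_n⁻¹ g⁻¹ t_n after free reduction, so by induction
-- u_n is, as a cyclic word, made of the period g^{±1} h⁻¹ g^{±1} h: single g-letters separate
-- h-letters of alternating sign. This survives rotation, passing to subwords and inversion,
-- whereas a square word contains two h-letters of the same sign two positions apart.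
module Submission where

open import Defs
open import Data.Nat using (ℕ; zero; suc; _≤_)
open import Data.List using ([]; _∷_; _++_; [_]; foldr; reverse; map; take)
open import Data.List.Properties
  using (foldr-++; take++drop≡id; unfold-reverse; reverse-map; reverse-involutive; map-∘; map-cong; map-id)
open import Data.List.Membership.Propositional using (_∈_)
open import Data.List.Relation.Unary.All using (All; []; _∷_; lookup)
open import Data.Product using (∃₂; ∃-syntax; _×_; _,_; proj₂)
open import Data.Sum using (inj₁; inj₂)
open import Function using (_∘_; id)
open import Relation.Nullary using (¬_)
open import Relation.Binary.PropositionalEquality
  using (_≡_; refl; sym; trans; cong; subst; module ≡-Reasoning)

invL-involutive : ∀ x → invL (invL x) ≡ x
invL-involutive g  = refl
invL-involutive g⁻ = refl
invL-involutive h  = refl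
invL-involutive h⁻ = refl

inv-involutive : ∀ w → inv (inv w) ≡ w
inv-involutive w = begin
  reverse (map invL (reverse (map invL w))) ≡⟨ cong reverse (reverse-map invL (map invL w)) ⟩
  reverse (reverse (map invL (map invL w))) ≡⟨ reverse-involutive _ ⟩
  map invL (map invL w)                     ≡⟨ map-∘ w ⟨
  map (invL ∘ invL) w                       ≡⟨ map-cong invL-involutive w ⟩
  map id w                                  ≡⟨ map-id w ⟩
  w                                         ∎
  where open ≡-Reasoning

inv-∷ : ∀ x w → inv (x ∷ w) ≡ inv w ++ [ invL x ]
inv-∷ x w = unfold-reverse (invL x) (map invL w)

-- In phase k the next letter must be the k-th letter of the period g^{±1} h⁻ g^{±1} h, so
-- Walk a w b says that w is a factor of (g^{±1} h⁻ g^{±1} h)^∞ read from phase a to phase b.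
data Phase : Set where
  p0 p1 p2 p3 : Phase

data Step : Phase → Letter → Phase → Set where
  g₀ : Step p0 g p1
  g⁻₀ : Step p0 g⁻ p1
  h⁻₁ : Step p1 h⁻ p2
  g₂ : Step p2 g p3
  g⁻₂ : Step p2 g⁻ p3
  h₃ : Step p3 h p0

infixr 5 _∷_ _++ʷ_

data Walk : Phase → Word → Phase → Set where
  [] : ∀ {a} → Walk a [] a
  _∷_ : ∀ {a b c x w} → Step a x b → Walk b w c → Walk a (x ∷ w) c

_++ʷ_ : ∀ {a b c xs ys} → Walk a xs b → Walk b ys c → Walk a (xs ++ ys) c
[] ++ʷ q = q
(s ∷ p) ++ʷ q = s ∷ (p ++ʷ q)

walk-++⁻ : ∀ {a c} xs {ys} → Walk a (xs ++ ys) c → ∃[ b ] Walk a xs b × Walk b ys c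
walk-++⁻ [] p = _ , [] , p
walk-++⁻ (_ ∷ xs) (s ∷ p) with walk-++⁻ xs p
... | b , q , r = b , s ∷ q , r

walk-rotate : ∀ {a w} i → Walk a w a → ∃[ b ] Walk b (rotate i w) b
walk-rotate {w = w} i p with walk-++⁻ (take i w) (subst (λ v → Walk _ v _) (sym (take++drop≡id i w)) p)
... | b , q , r = b , r ++ʷ q

walk-subword : ∀ {a b v w} → Walk a w b → Subword v w → ∃₂ λ c d → Walk c v d
walk-subword {v = v} p (xs , ys , refl) with walk-++⁻ xs p
... | _ , _ , q with walk-++⁻ v q
... | _ , r , _ = _ , _ , r

-- Inversion reads the period backwards, i.e. reflects the phase k ↦ 1 - k (mod 4).
mirror : Phase → Phase
mirror p0 = p1
mirror p1 = p0
mirror p2 = p3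
mirror p3 = p2

step-inv : ∀ {a x b} → Step a x b → Step (mirror b) (invL x) (mirror a)
step-inv g₀ = g⁻₀
step-inv g⁻₀ = g₀
step-inv h⁻₁ = h₃
step-inv g₂ = g⁻₂
step-inv g⁻₂ = g₂
step-inv h₃ = h⁻₁

walk-inv : ∀ {a w b} → Walk a w b → Walk (mirror b) (inv w) (mirror a)
walk-inv [] = []
walk-inv {w = x ∷ w} (s ∷ p) rewrite inv-∷ x w = walk-inv p ++ʷ step-inv s ∷ []

walk-cyclicSubword : ∀ {a v w} → Walk a w a → CyclicSubword v w → ∃₂ λ b c → Walk b v c
walk-cyclicSubword p (i , _ , inj₁ v⊑w) = walk-subword (proj₂ (walk-rotate i p)) v⊑w
walk-cyclicSubword {v = v} p (i , _ , inj₂ v⁻¹⊑w) with walk-subword (proj₂ (walk-rotate i p)) v⁻¹⊑w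
... | _ , _ , q = _ , _ , subst (λ w → Walk _ w _) (inv-involutive v) (walk-inv q)

-- Consecutive letters of a walk alternate between g^{±1} and h^{±1}, so never cancel.
push-walk : ∀ {a b c x w} → Step a x b → Walk b w c → push x w ≡ x ∷ w
push-walk _ [] = refl
push-walk g₀ (h⁻₁ ∷ _) = refl
push-walk g⁻₀ (h⁻₁ ∷ _) = refl
push-walk h⁻₁ (g₂ ∷ _) = refl
push-walk h⁻₁ (g⁻₂ ∷ _) = refl
push-walk g₂ (h₃ ∷ _) = refl
push-walk g⁻₂ (h₃ ∷ _) = refl
push-walk h₃ (g₀ ∷ _) = refl
push-walk h₃ (g⁻₀ ∷ _) = refl

reduce-walk : ∀ {a w b} → Walk a w b → reduce w ≡ w
reduce-walk [] = refl
reduce-walk {w = x ∷ w} (s ∷ p) = trans (cong (push x) (reduce-walk p)) (push-walk s p)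

next-tail : Word → Word
next-tail t = (inv t ++ [ g⁻ ]) ++ t

walk-next-tail : ∀ {t} → Walk p1 t p0 → Walk p1 (next-tail t) p0
walk-next-tail p = (walk-inv p ++ʷ g⁻₀ ∷ []) ++ʷ p

comm1-g-∷ : ∀ {t} → Walk p1 t p0 → comm1 [ g ] (g ∷ t) ≡ g ∷ next-tail t
comm1-g-∷ {t} p = begin
  reduce (g ∷ inv (g ∷ t) ++ g⁻ ∷ g ∷ t) ≡⟨ cong (λ v → reduce (g ∷ v ++ g⁻ ∷ g ∷ t)) (inv-∷ g t) ⟩
  reduce (xs ++ g⁻ ∷ g ∷ t)              ≡⟨ foldr-++ push [] xs (g⁻ ∷ g ∷ t) ⟩
  foldr push (reduce (g⁻ ∷ g ∷ t)) xs    ≡⟨ cong (λ r → foldr push r xs) cancel ⟩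
  foldr push (reduce t) xs               ≡⟨ foldr-++ push [] xs t ⟨
  reduce (xs ++ t)                       ≡⟨ reduce-walk (g₀ ∷ walk-next-tail p) ⟩
  g ∷ next-tail t                        ∎
  where
  open ≡-Reasoning
  xs : Word
  xs = g ∷ inv t ++ [ g⁻ ]
  cancel : reduce (g⁻ ∷ g ∷ t) ≡ reduce t
  cancel = trans (cong (push g⁻) (reduce-walk (g₀ ∷ p))) (sym (reduce-walk p))

u-walk : ∀ n → ∃[ t ] u (suc n) ≡ g ∷ t × Walk p1 t p0
u-walk zero = _ , refl , h⁻₁ ∷ g⁻₂ ∷ h₃ ∷ []
u-walk (suc n) with u-walk n
... | t , u≡gt , p = next-tail t , trans (cong (comm1 [ g ]) u≡gt) (comm1-g-∷ p) , walk-next-tail p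

u-closed-walk : ∀ n → Walk p0 (u (suc n)) p0
u-closed-walk n with u-walk n
... | t , u≡gt , p = subst (λ w → Walk p0 w p0) (sym u≡gt) (g₀ ∷ p)

squareWords-no-walk : All (λ s → ∀ {a b} → ¬ Walk a s b) squareWords
squareWords-no-walk =
    (λ { (g₀ ∷ () ∷ _) ; (g₂ ∷ h₃ ∷ g₀ ∷ () ∷ _) })
  ∷ (λ { (h₃ ∷ g₀ ∷ () ∷ _) })
  ∷ (λ { (h⁻₁ ∷ g⁻₂ ∷ () ∷ _) })
  ∷ (λ { (g⁻₀ ∷ h⁻₁ ∷ g⁻₂ ∷ () ∷ _) ; (g⁻₂ ∷ () ∷ _) })
  ∷ (λ { (g₀ ∷ h⁻₁ ∷ g₂ ∷ () ∷ _) ; (g₂ ∷ () ∷ _) })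
  ∷ (λ { (h⁻₁ ∷ g₂ ∷ () ∷ _) })
  ∷ (λ { (h₃ ∷ g⁻₀ ∷ () ∷ _) })
  ∷ (λ { (g⁻₀ ∷ () ∷ _) ; (g⁻₂ ∷ h₃ ∷ g⁻₀ ∷ () ∷ _) })
  ∷ []

lemma3p11 : ∀ (n : ℕ) → 1 ≤ n → ∀ (s : Word) → s ∈ squareWords → ¬ CyclicSubword s (u n)
lemma3p11 (suc n) _ s s∈ s⊑u with walk-cyclicSubword (u-closed-walk n) s⊑u
... | _ , _ , walk-s = lookup squareWords-no-walk s∈ walk-s
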